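{- For every represented space $\mathbf{X}$, the space $(\mathcal{A}\wedge\mathcal{V})(\mathbf{X})$ is computably Hausdorff.
   Context: A represented space $\mathbf{X}=(X,\delta_X)$ is a set with a partial surjection $\delta_X:\subseteq\mathbb{N}^\mathbb{N}\to X$; computability of maps means having computable realizers. $\mathbb{S}=\{\top,\bot\}$ is Sierpiński space ($p$ names $\top$ iff $p$ has a nonzero entry). $\mathcal{O}(\mathbf{X})$: open subsets, identified with characteristic maps $\mathbf{X}\to\mathbb{S}$. $\mathcal{A}(\mathbf{X})$: closed subsets represented via their complements in $\mathcal{O}(\mathbf{X})$. $\mathcal{V}(\mathbf{X})$: closed sets $A$ represented by $U\mapsto\top$ iff $A\cap U\neq\emptyset$. $(\mathcal{A}\wedge\mathcal{V})(\mathbf{X})$: closed subsets with names consisting of both an $\mathcal{A}$-name and a $\mathcal{V}$-name. A represented space $\mathbf{Y}$ is computably Hausdorff if inequality $\neq:\mathbf{Y}\times\mathbf{Y}\to\mathbb{S}$ (sending $(y,z)$ to $\top$ iff $y\neq z$) is computable. -}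

module Defs where

open import Data.Nat using (ℕ; zero; suc; _+_; _*_; _<_)
open import Data.Product using (Σ; ∃; _×_; _,_; proj₁; proj₂)
open import Data.List using (List; []; _∷_; _++_)
open import Relation.Binary.PropositionalEquality using (_≡_; _≢_)
open import Relation.Nullary using (¬_)

Baire : Set
Baire = ℕ → ℕ

tri : ℕ → ℕ
tri zero    = zero
tri (suc d) = suc d + tri d

⟪_,_⟫ : ℕ → ℕ → ℕ
⟪ a , b ⟫ = tri (a + b) + b

-- its inverse, by enumerating the diagonals (d,0),(d-1,1),...,(0,d)
unpair : ℕ → ℕ × ℕ
unpair zero    = zero , zero
unpair (suc n) with unpair n
... | zero  , b = suc b , zero
... | suc a , b = a , suc b

codeList : List ℕ → ℕ
codeList []       = zero
codeList (x ∷ xs) = suc ⟪ x , codeList xs ⟫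

prefix : Baire → ℕ → List ℕ
prefix q zero    = []
prefix q (suc k) = prefix q k ++ (q k ∷ [])

-- pairing on Baire space: ⟨p,q⟩(2n) = p n, ⟨p,q⟩(2n+1) = q n
joinB : Baire → Baire → Baire
joinB p q zero          = p zero
joinB p q (suc zero)    = q zero
joinB p q (suc (suc n)) = joinB (λ i → p (suc i)) (λ i → q (suc i)) n

evens : Baire → Baire
evens p n = p (n * 2)

odds : Baire → Baire
odds p n = p (suc (n * 2))

data PR : Set where
  zer suc' id' fst' snd' : PR
  pair' comp rec : PR → PR → PR
  mu : PR → PR

data Eval : PR → ℕ → ℕ → Set where
  ev-zer  : ∀ {n} → Eval zer n zero
  ev-suc  : ∀ {n} → Eval suc' n (suc n)
  ev-id   : ∀ {n} → Eval id' n n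
  ev-fst  : ∀ {n} → Eval fst' n (proj₁ (unpair n))
  ev-snd  : ∀ {n} → Eval snd' n (proj₂ (unpair n))
  ev-pair : ∀ {f g n a b} → Eval f n a → Eval g n b → Eval (pair' f g) n ⟪ a , b ⟫
  ev-comp : ∀ {f g n m k} → Eval g n m → Eval f m k → Eval (comp f g) n k
  ev-rec0 : ∀ {f g a m} → Eval f a m → Eval (rec f g) ⟪ a , zero ⟫ m
  ev-recS : ∀ {f g a k r m} → Eval (rec f g) ⟪ a , k ⟫ r →
            Eval g ⟪ ⟪ a , k ⟫ , r ⟫ m → Eval (rec f g) ⟪ a , suc k ⟫ m
  ev-mu   : ∀ {f n m} → Eval f ⟪ n , m ⟫ zero →
            (∀ j → j < m → ∃ λ v → Eval f ⟪ n , j ⟫ (suc v)) →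
            Eval (mu f) n m

Computable : Baire → Set
Computable c = Σ PR λ e → ∀ n → Eval e n (c n)

-- Kleene associates: the standard representation of continuous
-- partial functions on Baire space.  Φ p q r : "Φ_p(q) = r".

AssocOut : Baire → Baire → ℕ → ℕ → Set
AssocOut p q n m =
  Σ ℕ λ k → (p ⟪ n , codeList (prefix q k) ⟫ ≡ suc m)
          × (∀ j → j < k → p ⟪ n , codeList (prefix q j) ⟫ ≡ zero)

Φ : Baire → Baire → Baire → Set
Φ p q r = ∀ n → AssocOut p q n (r n)

record RepSpace : Set₁ where
  field
    Carrier    : Set
    δ          : Baire → Carrier → Set
    functional : ∀ {p x y} → δ p x → δ p y → x ≡ y
    surjective : ∀ x → Σ Baire λ p → δ p x

-- r is a Sierpiński name of the truth value of P
-- (r names ⊤ iff r has a nonzero entry)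
NamesS : Baire → Set → Set
NamesS r P = (P → ∃ λ n → r n ≢ zero) × ((∃ λ n → r n ≢ zero) → P)

Subset : Set → Set₁
Subset X = X → Set

_≈ₛ_ : {X : Set} → Subset X → Subset X → Set
A ≈ₛ B = ∀ x → (A x → B x) × (B x → A x)

module _ (𝐗 : RepSpace) where
  open RepSpace 𝐗

  -- p is an O(X)-name of U: Φ_p realizes the characteristic map X → 𝕊 of U
  NamesO : Baire → Subset Carrier → Set
  NamesO p U = ∀ q x → δ q x → Σ Baire λ r → Φ p q r × NamesS r (U x)

  NamesA : Baire → Subset Carrier → Set
  NamesA p A = NamesO p (λ x → ¬ A x)

  -- V(X): Φ_p realizes U ↦ [A ∩ U ≠ ∅] on O(X)-names
  NamesV : Baire → Subset Carrier → Set₁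
  NamesV p A = ∀ q U → NamesO q U →
               Σ Baire λ r → Φ p q r × NamesS r (∃ λ x → A x × U x)

  NamesAV : Baire → Subset Carrier → Set₁
  NamesAV p A = NamesA (evens p) A × NamesV (odds p) A

  AVComputablyHausdorff : Set₁
  AVComputablyHausdorff =
    Σ Baire λ c → Computable c ×
      (∀ p q (A B : Subset Carrier) → NamesAV p A → NamesAV q B →
         Σ Baire λ r → Φ c (joinB p q) r × NamesS r (¬ (A ≈ₛ B)))

module Submission where

-- Classically, closed sets A and B differ iff A meets the complement of B or B meets the
-- complement of A.  An A-name of B is an O-name of its complement, so feeding it to a V-name of
-- A yields a Sierpiński name r₀ of [A ∩ Bᶜ ≠ ∅]; symmetrically r₁ names [B ∩ Aᶜ ≠ ∅], and the
-- interleaving n ↦ r_{π₁ n}(π₂ n) names [A ≠ B].  The substance of the proof is that this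
-- interleaving is computed from the joined names ⟨p , q⟩ by a single computable Kleene
-- associate: a universal associate, simulating one half of its input applied to the other.

open import Defs
open import Data.Nat using (ℕ; zero; suc; _+_; _*_; _∸_; pred; _≤_; _<_; _<?_; z≤n; s≤s; ∣_-_∣)
open import Data.Nat.Properties
open import Data.Nat.GeneralisedArithmetic using (fold; iterate; iterate-is-fold)
open import Data.Product using (Σ; ∃; _×_; _,_; proj₁; proj₂)
open import Data.Sum using (_⊎_; inj₁; inj₂)
open import Data.Empty using (⊥-elim)
open import Data.List using ([]; _∷_; _++_)
open import Relation.Binary.PropositionalEquality
open import Relation.Nullary using (¬_; yes; no)
open import Relation.Nullary.Decidable using (decidable-stable)
open import Function.Bundles using (_⇔_; mk⇔; Equivalence)
open import Level using (0ℓ)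
open import Axiom.ExcludedMiddle using (ExcludedMiddle)

-- ⟪_,_⟫ enumerates ℕ × ℕ diagonal by diagonal; its two successor steps are the following.
pair-next-diagonal : ∀ a → ⟪ suc a , zero ⟫ ≡ suc ⟪ zero , a ⟫
pair-next-diagonal a rewrite +-identityʳ a | +-identityʳ (a + tri a) = cong suc (+-comm a (tri a))

pair-along-diagonal : ∀ a b → ⟪ a , suc b ⟫ ≡ suc ⟪ suc a , b ⟫
pair-along-diagonal a b rewrite +-suc a b = +-suc (tri (suc (a + b))) b

pair-unpair : ∀ n → ⟪ proj₁ (unpair n) , proj₂ (unpair n) ⟫ ≡ n
pair-unpair zero = refl
pair-unpair (suc n) with unpair n | pair-unpair n
... | zero  , b | eq = trans (pair-next-diagonal b) (cong suc eq)
... | suc a , b | eq = trans (pair-along-diagonal a b) (cong suc eq)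

nextPair : ℕ × ℕ → ℕ × ℕ
nextPair (zero  , b) = suc b , zero
nextPair (suc a , b) = a , suc b

unpair-suc : ∀ n → unpair (suc n) ≡ nextPair (unpair n)
unpair-suc n with unpair n
... | zero  , b = refl
... | suc a , b = refl

unpair-pair : ∀ a b → unpair ⟪ a , b ⟫ ≡ (a , b)
unpair-pair a b = onDiagonal (a + b) a b refl
  where
  onDiagonal : ∀ d a b → a + b ≡ d → unpair ⟪ a , b ⟫ ≡ (a , b)
  onDiagonal d zero zero _ = refl
  onDiagonal (suc d) (suc a) zero eq = begin
    unpair ⟪ suc a , zero ⟫       ≡⟨ cong unpair (pair-next-diagonal a) ⟩
    unpair (suc ⟪ zero , a ⟫)     ≡⟨ unpair-suc ⟪ zero , a ⟫ ⟩
    nextPair (unpair ⟪ zero , a ⟫) ≡⟨ cong nextPair (onDiagonal d zero a (trans (sym (+-identityʳ a)) (suc-injective eq))) ⟩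
    (suc a , zero)                ∎
    where open ≡-Reasoning
  onDiagonal d a (suc b) eq = begin
    unpair ⟪ a , suc b ⟫           ≡⟨ cong unpair (pair-along-diagonal a b) ⟩
    unpair (suc ⟪ suc a , b ⟫)     ≡⟨ unpair-suc ⟪ suc a , b ⟫ ⟩
    nextPair (unpair ⟪ suc a , b ⟫) ≡⟨ cong nextPair (onDiagonal d (suc a) b (trans (sym (+-suc a b)) eq)) ⟩
    (a , suc b)                    ∎
    where open ≡-Reasoning

-- The pairing and its projections, kept opaque so that only their defining equations are used
-- (unfolding the pairing function would blow up every term built from it).
opaque
  ⟦_,_⟧ : ℕ → ℕ → ℕ
  ⟦ a , b ⟧ = ⟪ a , b ⟫

  ⟦⟧-def : ∀ a b → ⟪ a , b ⟫ ≡ ⟦ a , b ⟧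
  ⟦⟧-def a b = refl

  π₁ π₂ : ℕ → ℕ
  π₁ n = proj₁ (unpair n)
  π₂ n = proj₂ (unpair n)

  π₁-unpair : ∀ n → proj₁ (unpair n) ≡ π₁ n
  π₁-unpair n = refl

  π₂-unpair : ∀ n → proj₂ (unpair n) ≡ π₂ n
  π₂-unpair n = refl

  π₁-pair : ∀ a b → π₁ ⟦ a , b ⟧ ≡ a
  π₁-pair a b = cong proj₁ (unpair-pair a b)

  π₂-pair : ∀ a b → π₂ ⟦ a , b ⟧ ≡ b
  π₂-pair a b = cong proj₂ (unpair-pair a b)

  pair-π : ∀ n → ⟦ π₁ n , π₂ n ⟧ ≡ n
  pair-π = pair-unpair

record CompFn : Set where
  field
    fn       : ℕ → ℕ
    prog     : PR
    computes : ∀ n → Eval prog n (fn n)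
open CompFn

realise : (f : ℕ → ℕ) (c : CompFn) → (∀ n → fn c n ≡ f n) → CompFn
realise f c eq = record
  { fn = f ; prog = prog c ; computes = λ n → subst (Eval (prog c) n) (eq n) (computes c n) }

idC π₁C π₂C : CompFn
idC = record { fn = λ n → n ; prog = id' ; computes = λ _ → ev-id }
π₁C = record { fn = π₁ ; prog = fst' ; computes = λ n → subst (Eval fst' n) (π₁-unpair n) ev-fst }
π₂C = record { fn = π₂ ; prog = snd' ; computes = λ n → subst (Eval snd' n) (π₂-unpair n) ev-snd }

sucC : CompFn → CompFn
sucC c = record
  { fn = λ n → suc (fn c n) ; prog = comp suc' (prog c) ; computes = λ n → ev-comp (computes c n) ev-suc }

K : ℕ → CompFn
K zero    = record { fn = λ _ → zero ; prog = zer ; computes = λ _ → ev-zer }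
K (suc k) = sucC (K k)

infixr 9 _∘C_
_∘C_ : CompFn → CompFn → CompFn
f ∘C g = record
  { fn = λ n → fn f (fn g n) ; prog = comp (prog f) (prog g)
  ; computes = λ n → ev-comp (computes g n) (computes f (fn g n)) }

⟨_,_⟩C : CompFn → CompFn → CompFn
⟨ f , g ⟩C = record
  { fn = λ n → ⟦ fn f n , fn g n ⟧ ; prog = pair' (prog f) (prog g)
  ; computes = λ n → subst (Eval _ n) (⟦⟧-def (fn f n) (fn g n)) (ev-pair (computes f n) (computes g n)) }

iterC : (h a k : CompFn) → CompFn
iterC h a k = record
  { fn = λ n → fold (fn a n) (fn h) (fn k n)
  ; prog = comp loop (pair' (prog a) (prog k))
  ; computes = λ n → ev-comp (ev-pair (computes a n) (computes k n)) (runs (fn a n) (fn k n)) }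
  where
  loop : PR
  loop = rec id' (comp (prog h) snd')

  runs : ∀ a k → Eval loop ⟪ a , k ⟫ (fold a (fn h) k)
  runs a zero    = ev-rec0 ev-id
  runs a (suc k) = ev-recS {a = a} {k = k} (runs a k)
    (ev-comp (subst (Eval snd' _) (cong proj₂ (unpair-pair ⟪ a , k ⟫ (fold a (fn h) k))) ev-snd)
             (computes h (fold a (fn h) k)))

fold-encode : {S : Set} (enc : S → ℕ) {h : ℕ → ℕ} {g : S → S} →
              (∀ σ → h (enc σ) ≡ enc (g σ)) → ∀ σ k → fold (enc σ) h k ≡ enc (fold σ g k)
fold-encode enc step σ zero    = refl
fold-encode enc {h} {g} step σ (suc k) = trans (cong h (fold-encode enc step σ k)) (step (fold σ g k))

if0 : {A : Set} → ℕ → A → A → A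
if0 zero    a _ = a
if0 (suc _) _ b = b

-- pred, by iterating ⟦ pred j , j ⟧ ↦ ⟦ j , suc j ⟧.
predC : CompFn → CompFn
predC x = realise (λ n → pred (fn x n))
  (π₁C ∘C iterC ⟨ π₂C , sucC π₂C ⟩C ⟨ K 0 , K 0 ⟩C x) (λ n → result (fn x n))
  where
  shift : ℕ → ℕ
  shift s = ⟦ π₂ s , suc (π₂ s) ⟧

  states : ∀ j → fold ⟦ 0 , 0 ⟧ shift j ≡ ⟦ pred j , j ⟧
  states zero    = refl
  states (suc j) = trans (cong shift (states j)) (cong₂ (λ u v → ⟦ u , suc v ⟧) (π₂-pair (pred j) j) (π₂-pair (pred j) j))

  result : ∀ j → π₁ (fold ⟦ 0 , 0 ⟧ shift j) ≡ pred j
  result j = trans (cong π₁ (states j)) (π₁-pair (pred j) j)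

-- if0, by iterating ⟦ a , b ⟧ ↦ ⟦ b , b ⟧: the first component is a until the first step.
ifzC : CompFn → CompFn → CompFn → CompFn
ifzC c x y = realise (λ n → if0 (fn c n) (fn x n) (fn y n))
  (π₁C ∘C iterC ⟨ π₂C , π₂C ⟩C ⟨ x , y ⟩C c) (λ n → select (fn x n) (fn y n) (fn c n))
  where
  dup : ℕ → ℕ
  dup s = ⟦ π₂ s , π₂ s ⟧

  keeps : ∀ a b j → π₂ (fold ⟦ a , b ⟧ dup j) ≡ b
  keeps a b zero    = π₂-pair a b
  keeps a b (suc j) = trans (π₂-pair (π₂ s) (π₂ s)) (keeps a b j)
    where
    s : ℕ
    s = fold ⟦ a , b ⟧ dup j

  select : ∀ a b j → π₁ (fold ⟦ a , b ⟧ dup j) ≡ if0 j a b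
  select a b zero    = π₁-pair a b
  select a b (suc j) = trans (π₁-pair (π₂ s) (π₂ s)) (keeps a b j)
    where
    s : ℕ
    s = fold ⟦ a , b ⟧ dup j

infixl 6 _+C_ _∸C_

_+C_ : CompFn → CompFn → CompFn
x +C y = realise (λ n → fn x n + fn y n) (iterC (sucC idC) x y)
  (λ n → trans (sum (fn x n) (fn y n)) (+-comm (fn y n) (fn x n)))
  where
  sum : ∀ a k → fold a suc k ≡ k + a
  sum a zero    = refl
  sum a (suc k) = cong suc (sum a k)

_∸C_ : CompFn → CompFn → CompFn
x ∸C y = realise (λ n → fn x n ∸ fn y n) (iterC (predC idC) x y) (λ n → monus (fn x n) (fn y n))
  where
  monus : ∀ a k → fold a pred k ≡ a ∸ k
  monus a zero    = refl
  monus a (suc k) = trans (cong pred (monus a k)) (pred[m∸n]≡m∸[1+n] a k)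

distC : CompFn → CompFn → CompFn
distC x y = realise (λ n → ∣ fn x n - fn y n ∣) ((x ∸C y) +C (y ∸C x)) (λ n → dist (fn x n) (fn y n))
  where
  dist : ∀ a b → (a ∸ b) + (b ∸ a) ≡ ∣ a - b ∣
  dist zero    zero    = refl
  dist zero    (suc b) = refl
  dist (suc a) zero    = +-identityʳ (suc a)
  dist (suc a) (suc b) = dist a b

doubleC : CompFn → CompFn
doubleC x = realise (λ n → fn x n * 2) (x +C x) (λ n → sym (double (fn x n)))
  where
  double : ∀ a → a * 2 ≡ a + a
  double a = trans (*-comm a 2) (cong (a +_) (+-identityʳ a))

code : (ℕ → ℕ) → ℕ → ℕ
code f m = codeList (prefix f m)

-- prefixes are defined by appending at the end; codes are read from the front
prefix-cons : ∀ f m → prefix f (suc m) ≡ f 0 ∷ prefix (λ j → f (suc j)) m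
prefix-cons f zero    = refl
prefix-cons f (suc m) = cong (_++ f (suc m) ∷ []) (prefix-cons f m)

code-cons : ∀ f m → code f (suc m) ≡ suc ⟦ f 0 , code (λ j → f (suc j)) m ⟧
code-cons f m = trans (cong codeList (prefix-cons f m)) (cong suc (⟦⟧-def (f 0) _))

code-cong : ∀ f g m → (∀ j → j < m → f j ≡ g j) → code f m ≡ code g m
code-cong f g m agree = cong codeList (prefixes m agree)
  where
  prefixes : ∀ m → (∀ j → j < m → f j ≡ g j) → prefix f m ≡ prefix g m
  prefixes zero    _     = refl
  prefixes (suc m) agree = cong₂ (λ l v → l ++ v ∷ [])
    (prefixes m (λ j j<m → agree j (m≤n⇒m≤1+n j<m))) (agree m ≤-refl)

pair-monoʳ : ∀ a {b b′} → b ≤ b′ → ⟦ a , b ⟧ ≤ ⟦ a , b′ ⟧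
pair-monoʳ a {b} {b′} b≤b′ rewrite sym (⟦⟧-def a b) | sym (⟦⟧-def a b′) = +-mono-≤ (tri-mono (+-monoʳ-≤ a b≤b′)) b≤b′
  where
  tri-mono : ∀ {m n} → m ≤ n → tri m ≤ tri n
  tri-mono z≤n               = z≤n
  tri-mono (s≤s m≤n) = +-mono-≤ (s≤s m≤n) (tri-mono m≤n)

snd≤pair : ∀ a b → b ≤ ⟦ a , b ⟧
snd≤pair a b rewrite sym (⟦⟧-def a b) = m≤n+m b (tri (a + b))

length≤code : ∀ f m → m ≤ code f m
length≤code f zero    = z≤n
length≤code f (suc m) rewrite code-cons f m =
  s≤s (≤-trans (length≤code (λ j → f (suc j)) m) (snd≤pair (f 0) _))

code-mono : ∀ f {m m′} → m ≤ m′ → code f m ≤ code f m′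
code-mono f {zero}              _         = z≤n
code-mono f {suc m} {suc m′} (s≤s m≤m′) rewrite code-cons f m | code-cons f m′ =
  s≤s (pair-monoʳ (f 0) (code-mono (λ j → f (suc j)) m≤m′))

head tail : ℕ → ℕ
head c = π₁ (pred c)
tail c = π₂ (pred c)

tail-code : ∀ f m → tail (code f (suc m)) ≡ code (λ j → f (suc j)) m
tail-code f m rewrite code-cons f m = π₂-pair (f 0) _

lookup : ℕ → ℕ → ℕ
lookup w k = head (iterate tail w k)

lookup-code : ∀ f M k → k < M → lookup (code f M) k ≡ f k
lookup-code f M k k<M = begin
  lookup (code f M) k                              ≡⟨ cong (λ n → lookup (code f n) k) M≡k+1+L ⟩
  head (iterate tail (code f (k + suc L)) k)       ≡⟨ cong head (drop k f) ⟩
  head (code (λ j → f (k + j)) (suc L))            ≡⟨ cong head (code-cons (λ j → f (k + j)) L) ⟩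
  π₁ ⟦ f (k + 0) , code (λ j → f (k + suc j)) L ⟧ ≡⟨ π₁-pair (f (k + 0)) _ ⟩
  f (k + 0)                                        ≡⟨ cong f (+-identityʳ k) ⟩
  f k                                              ∎
  where
  open ≡-Reasoning
  L : ℕ
  L = M ∸ suc k
  M≡k+1+L : M ≡ k + suc L
  M≡k+1+L = sym (trans (+-suc k L) (m+[n∸m]≡n k<M))
  drop : ∀ k f → iterate tail (code f (k + suc L)) k ≡ code (λ j → f (k + j)) (suc L)
  drop zero    f = refl
  drop (suc k) f = trans (cong (λ c → iterate tail c k) (tail-code f (k + suc L))) (drop k (λ j → f (suc j)))

lengthStep : ℕ × ℕ → ℕ × ℕ
lengthStep (zero  , n) = zero , n
lengthStep (suc c , n) = π₂ c , suc n

length : ℕ → ℕ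
length w = proj₂ (iterate lengthStep (w , 0) w)

length-code : ∀ f m → length (code f m) ≡ m
length-code f m = begin
  proj₂ (iterate lengthStep (code f m , 0) (code f m))      ≡⟨ cong (λ k → proj₂ (iterate lengthStep (code f m , 0) k)) (sym (m+[n∸m]≡n (length≤code f m))) ⟩
  proj₂ (iterate lengthStep (code f m , 0) (m + (code f m ∸ m))) ≡⟨ cong proj₂ (run f m 0 (code f m ∸ m)) ⟩
  m + 0                                                     ≡⟨ +-identityʳ m ⟩
  m                                                         ∎
  where
  open ≡-Reasoning
  idle : ∀ n d → iterate lengthStep (0 , n) d ≡ (0 , n)
  idle n zero    = refl
  idle n (suc d) = idle n d
  run : ∀ f m n d → iterate lengthStep (code f m , n) (m + d) ≡ (0 , m + n)
  run f zero    n d = idle n d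
  run f (suc m) n d = begin
    iterate lengthStep (code f (suc m) , n) (suc m + d)                          ≡⟨ cong (λ c → iterate lengthStep (c , n) (suc m + d)) (code-cons f m) ⟩
    iterate lengthStep (π₂ ⟦ f 0 , code (λ j → f (suc j)) m ⟧ , suc n) (m + d) ≡⟨ cong (λ c → iterate lengthStep (c , suc n) (m + d)) (π₂-pair (f 0) _) ⟩
    iterate lengthStep (code (λ j → f (suc j)) m , suc n) (m + d)               ≡⟨ run (λ j → f (suc j)) m (suc n) d ⟩
    (0 , m + suc n)                                                             ≡⟨ cong (0 ,_) (+-suc m n) ⟩
    (0 , suc m + n)                                                             ∎

tailC : CompFn
tailC = π₂C ∘C predC idC

lookupC : CompFn → CompFn → CompFn
lookupC w k = realise (λ n → lookup (fn w n) (fn k n)) (π₁C ∘C predC (iterC tailC w k))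
  (λ n → cong head (iterate-is-fold (fn w n) tail (fn k n)))

encode₂ : ℕ × ℕ → ℕ
encode₂ σ = ⟦ proj₁ σ , proj₂ σ ⟧

lengthC : CompFn → CompFn
lengthC w = realise (λ n → length (fn w n)) (π₂C ∘C iterC stepC ⟨ w , K 0 ⟩C w) (λ n → count (fn w n))
  where
  stepC : CompFn
  stepC = ifzC π₁C idC ⟨ tailC ∘C π₁C , sucC π₂C ⟩C

  step : ∀ σ → fn stepC (encode₂ σ) ≡ encode₂ (lengthStep σ)
  step (c , n) rewrite π₁-pair c n | π₂-pair c n with c
  ... | zero  = refl
  ... | suc c = refl

  count : ∀ w → π₂ (fold ⟦ w , 0 ⟧ (fn stepC) w) ≡ length w
  count w = trans (cong π₂ (fold-encode encode₂ step (w , 0) w))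
    (trans (π₂-pair (proj₁ final) (proj₂ final)) (cong proj₂ (iterate-is-fold (w , 0) lengthStep w)))
    where
    final : ℕ × ℕ
    final = fold (w , 0) lengthStep w

π₂≤ : ∀ n → π₂ n ≤ n
π₂≤ n = subst (π₂ n ≤_) (pair-π n) (snd≤pair (π₁ n) (π₂ n))

-- Recognising the codes of prefixes of a sequence s: walk through the code c, comparing its
-- entries with s and accumulating the differences.  The state is (rest of c, position, error).
module PrefixTest (s : ℕ → ℕ) where

  step : ℕ × ℕ × ℕ → ℕ × ℕ × ℕ
  step (zero  , t , e) = zero , t , e
  step (suc c , t , e) = π₂ c , suc t , e + ∣ π₁ c - s t ∣

  -- the code is used up and no difference was found
  done : ℕ × ℕ × ℕ → ℕ
  done (c , _ , e) = c + e

  -- c steps suffice, since each step strictly decreases a nonzero code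
  mismatch : ℕ → ℕ
  mismatch c = done (iterate step (c , 0 , 0) c)

  private
    idle : ∀ F t e → iterate step (0 , t , e) F ≡ (0 , t , e)
    idle zero    t e = refl
    idle (suc F) t e = idle F t e

    sound : ∀ F c t e → c ≤ F → done (iterate step (c , t , e) F) ≡ 0 →
            e ≡ 0 × ∃ λ m → c ≡ code (λ j → s (t + j)) m
    sound F zero t e _ finished rewrite idle F t e = finished , 0 , refl
    sound (suc F) (suc c) t e (s≤s c≤F) finished
      with sound F (π₂ c) (suc t) (e + ∣ π₁ c - s t ∣) (≤-trans (π₂≤ c) c≤F) finished
    ... | e′≡0 , m , rest = m+n≡0⇒m≡0 e e′≡0 , suc m , (begin
      suc c                                                   ≡⟨ cong suc (sym (pair-π c)) ⟩
      suc ⟦ π₁ c , π₂ c ⟧                                      ≡⟨ cong₂ (λ a b → suc ⟦ a , b ⟧) first rest′ ⟩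
      suc ⟦ s (t + 0) , code (λ j → s (t + suc j)) m ⟧          ≡⟨ sym (code-cons (λ j → s (t + j)) m) ⟩
      code (λ j → s (t + j)) (suc m)                          ∎)
      where
      open ≡-Reasoning
      first : π₁ c ≡ s (t + 0)
      first = trans (∣m-n∣≡0⇒m≡n (m+n≡0⇒n≡0 e e′≡0)) (cong s (sym (+-identityʳ t)))
      rest′ : π₂ c ≡ code (λ j → s (t + suc j)) m
      rest′ = trans rest (code-cong _ _ m (λ j _ → cong s (sym (+-suc t j))))

    complete : ∀ F c t m → c ≤ F → c ≡ code (λ j → s (t + j)) m →
               done (iterate step (c , t , 0) F) ≡ 0
    complete F zero t m _ _ rewrite idle F t 0 = refl
    complete (suc F) (suc c) t zero    _          ()
    complete (suc F) (suc c) t (suc m) (s≤s c≤F) c≡code =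
      subst (λ e → done (iterate step (π₂ c , suc t , e) F) ≡ 0) (sym no-error)
        (complete F (π₂ c) (suc t) m (≤-trans (π₂≤ c) c≤F) rest)
      where
      c≡pair : c ≡ ⟦ s (t + 0) , code (λ j → s (t + suc j)) m ⟧
      c≡pair = suc-injective (trans c≡code (code-cons (λ j → s (t + j)) m))
      no-error : ∣ π₁ c - s t ∣ ≡ 0
      no-error = m≡n⇒∣m-n∣≡0 (trans (cong π₁ c≡pair) (trans (π₁-pair _ _) (cong s (+-identityʳ t))))
      rest : π₂ c ≡ code (λ j → s (suc t + j)) m
      rest = trans (cong π₂ c≡pair) (trans (π₂-pair (s (t + 0)) _) (code-cong _ _ m (λ j _ → cong s (+-suc t j))))

  mismatch-sound : ∀ c → mismatch c ≡ 0 → ∃ λ m → c ≡ code s m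
  mismatch-sound c eq = proj₂ (sound c c 0 0 ≤-refl eq)

  mismatch-complete : ∀ m → mismatch (code s m) ≡ 0
  mismatch-complete m = complete (code s m) (code s m) 0 m ≤-refl refl

mismatchC : (E P c : CompFn) → CompFn
mismatchC E P c =
  realise (λ n → PrefixTest.mismatch (λ t → fn E ⟦ fn P n , t ⟧) (fn c n))
          (resultC ∘C iterC stepC ⟨ P , ⟨ c , ⟨ K 0 , K 0 ⟩C ⟩C ⟩C c)
          (λ n → run (fn P n) (fn c n))
  where
  -- the state ⟦ P , ⟦ c , ⟦ t , e ⟧ ⟧ ⟧ carries the parameter P along
  codeC posC errC : CompFn
  codeC = π₁C ∘C π₂C
  posC  = π₁C ∘C π₂C ∘C π₂C
  errC  = π₂C ∘C π₂C ∘C π₂C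

  stepC resultC : CompFn
  stepC = ifzC codeC idC
    ⟨ π₁C , ⟨ tailC ∘C codeC , ⟨ sucC posC , errC +C distC (π₁C ∘C predC codeC) (E ∘C ⟨ π₁C , posC ⟩C) ⟩C ⟩C ⟩C
  resultC = codeC +C errC

  encode : ℕ → ℕ × ℕ × ℕ → ℕ
  encode P (c , t , e) = ⟦ P , ⟦ c , ⟦ t , e ⟧ ⟧ ⟧

  step : ∀ P σ → fn stepC (encode P σ) ≡ encode P (PrefixTest.step (λ t → fn E ⟦ P , t ⟧) σ)
  step P (c , t , e)
    rewrite π₁-pair P ⟦ c , ⟦ t , e ⟧ ⟧ | π₂-pair P ⟦ c , ⟦ t , e ⟧ ⟧
          | π₁-pair c ⟦ t , e ⟧ | π₂-pair c ⟦ t , e ⟧ | π₁-pair t e | π₂-pair t e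
    with c
  ... | zero  = refl
  ... | suc c = refl

  result : ∀ P σ → fn resultC (encode P σ) ≡ PrefixTest.done (λ t → fn E ⟦ P , t ⟧) σ
  result P (c , t , e)
    rewrite π₂-pair P ⟦ c , ⟦ t , e ⟧ ⟧ | π₁-pair c ⟦ t , e ⟧ | π₂-pair c ⟦ t , e ⟧ | π₂-pair t e = refl

  run : ∀ P c → fn resultC (fold (encode P (c , 0 , 0)) (fn stepC) c)
              ≡ PrefixTest.mismatch (λ t → fn E ⟦ P , t ⟧) c
  run P c = begin
    fn resultC (fold (encode P (c , 0 , 0)) (fn stepC) c) ≡⟨ cong (fn resultC) (fold-encode (encode P) (step P) (c , 0 , 0) c) ⟩
    fn resultC (encode P (fold (c , 0 , 0) walk c))       ≡⟨ result P (fold (c , 0 , 0) walk c) ⟩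
    PrefixTest.done s (fold (c , 0 , 0) walk c)           ≡⟨ cong (PrefixTest.done s) (iterate-is-fold (c , 0 , 0) walk c) ⟩
    PrefixTest.mismatch s c                               ∎
    where
    open ≡-Reasoning
    s : ℕ → ℕ
    s t = fn E ⟦ P , t ⟧
    walk : ℕ × ℕ × ℕ → ℕ × ℕ × ℕ
    walk = PrefixTest.step s

halveStep : ℕ × ℕ → ℕ × ℕ
halveStep (q , zero)  = q , 1
halveStep (q , suc _) = suc q , 0

half : ℕ → ℕ
half n = proj₁ (fold (0 , 0) halveStep n)

halve-even : ∀ n → fold (0 , 0) halveStep (n * 2) ≡ (n , 0)
halve-even zero    = refl
halve-even (suc n) = cong (λ σ → halveStep (halveStep σ)) (halve-even n)

half-+*2 : ∀ β n → β ≤ 1 → half (β + n * 2) ≡ n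
half-+*2 zero          n _ = cong proj₁ (halve-even n)
half-+*2 (suc zero)    n _ = cong (λ σ → proj₁ (halveStep σ)) (halve-even n)
half-+*2 (suc (suc β)) n (s≤s ())

halfC : CompFn → CompFn
halfC x = realise (λ n → half (fn x n)) (π₁C ∘C iterC stepC ⟨ K 0 , K 0 ⟩C x)
  (λ n → trans (cong π₁ (fold-encode encode₂ step (0 , 0) (fn x n))) (π₁-pair _ _))
  where
  stepC : CompFn
  stepC = ifzC π₂C ⟨ π₁C , K 1 ⟩C ⟨ sucC π₁C , K 0 ⟩C

  step : ∀ σ → fn stepC (encode₂ σ) ≡ encode₂ (halveStep σ)
  step (q , r) rewrite π₁-pair q r | π₂-pair q r with r
  ... | zero  = refl
  ... | suc r = refl

-- For the side
-- β ∈ {0,1}, entry T of the associate half lives at position slot β T, and entry t of the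
-- argument half at position argSlot β t (side 0: odds p applied to evens q; side 1: odds q to evens p).
slot argSlot : ℕ → ℕ → ℕ
slot β T    = β + suc (T * 2) * 2
argSlot β t = (1 ∸ β) + t * 2 * 2

assocHalf argHalf : ℕ → Baire → Baire
assocHalf β x T = x (slot β T)
argHalf   β x t = x (argSlot β t)

half-half-slot : ∀ β T → β ≤ 1 → half (half (slot β T)) ≡ T
half-half-slot β T β≤1 = trans (cong half (half-+*2 β (suc (T * 2)) β≤1)) (half-+*2 1 T (s≤s z≤n))

slot-mono : ∀ β {T T′} → T ≤ T′ → slot β T ≤ slot β T′
slot-mono β T≤T′ = +-monoʳ-≤ β (*-monoˡ-≤ 2 (s≤s (*-monoˡ-≤ 2 T≤T′)))

slot≢0 : ∀ β T → slot β T ≢ 0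
slot≢0 β T eq with m+n≡0⇒n≡0 β eq
... | ()

-- the argument entries that entry T may depend on are read before the slot of T
argSlot≤slot : ∀ β {t T} → t ≤ T → argSlot β t ≤ slot β T
argSlot≤slot β {t} {T} t≤T = begin
  (1 ∸ β) + t * 2 * 2      ≤⟨ +-mono-≤ (≤-trans (m∸n≤m 1 β) (s≤s z≤n)) (*-monoˡ-≤ 2 (*-monoˡ-≤ 2 t≤T)) ⟩
  2 + T * 2 * 2            ≤⟨ m≤n+m _ β ⟩
  slot β T                 ∎
  where open ≤-Reasoning

side : ℕ → ℕ
side b = if0 b 0 1

side≤1 : ∀ b → side b ≤ 1
side≤1 zero    = z≤n
side≤1 (suc b) = s≤s z≤n

slotC argSlotC : CompFn → CompFn → CompFn
slotC β T    = β +C doubleC (sucC (doubleC T))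
argSlotC β t = (K 1 ∸C β) +C doubleC (doubleC t)

-- entry t of the argument half of side β, read from the code w of a prefix of x
argEntryC : CompFn
argEntryC = lookupC (π₁C ∘C π₁C) (argSlotC (π₂C ∘C π₁C) π₂C)

argEntry : ℕ → ℕ → ℕ → ℕ
argEntry w β t = fn argEntryC ⟦ ⟦ w , β ⟧ , t ⟧

argEntry-code : ∀ x β L T t → L ≡ slot β T → t ≤ T →
                argEntry (code x (suc L)) β t ≡ argHalf β x t
argEntry-code x β L T t L≡slot t≤T
  rewrite π₁-pair ⟦ code x (suc L) , β ⟧ t | π₂-pair ⟦ code x (suc L) , β ⟧ t
        | π₁-pair (code x (suc L)) β | π₂-pair (code x (suc L)) β
  = lookup-code x (suc L) (argSlot β t) (s≤s (subst (argSlot β t ≤_) (sym L≡slot) (argSlot≤slot β t≤T)))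

-- hence the prefix test against the entries read from x(0 … L) is a test against x itself
argEntries-code : ∀ x β L T m → L ≡ slot β T → m ≤ T →
                  code (argEntry (code x (suc L)) β) m ≡ code (argHalf β x) m
argEntries-code x β L T m L≡slot m≤T =
  code-cong _ _ m (λ t t<m → argEntry-code x β L T t L≡slot (≤-trans (<⇒≤ t<m) m≤T))

-- On the query ⟦ ⟦ b , i ⟧ , w ⟧, with w the code of x(0) … x(L),
-- it looks at the last entry read, x(L): if L is the slot of entry ⟦ i , c ⟧ of the associate
-- half of side β = side b, and c codes a prefix of the argument half, it answers x(L), which is
-- that associate's answer to the query ⟦ i , c ⟧; otherwise it answers 0 ("not yet").
last candidate : ℕ → ℕ
last w      = pred (length w)
candidate w = π₂ (half (half (last w)))

slotError prefixError check : ℕ → ℕ → ℕ → ℕ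
slotError b i w   = ∣ last w - slot (side b) ⟦ i , candidate w ⟧ ∣
prefixError b i w = PrefixTest.mismatch (argEntry w (side b)) (candidate w)
check b i w       = slotError b i w + prefixError b i w

respond : ℕ → ℕ → ℕ → ℕ
respond b i w = if0 (check b i w) (lookup w (last w)) 0

univC : CompFn
univC = ifzC checkC (lookupC wordC lastC) (K 0)
  where
  bitC indexC wordC sideC lastC candidateC checkC : CompFn
  bitC       = π₁C ∘C π₁C
  indexC     = π₂C ∘C π₁C
  wordC      = π₂C
  sideC      = ifzC bitC (K 0) (K 1)
  lastC      = predC (lengthC wordC)
  candidateC = π₂C ∘C halfC (halfC lastC)
  checkC     = distC lastC (slotC sideC ⟨ indexC , candidateC ⟩C)
            +C mismatchC argEntryC ⟨ wordC , sideC ⟩C candidateC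

univ-query : ∀ b i w → fn univC ⟪ ⟦ b , i ⟧ , w ⟫ ≡ respond b i w
univ-query b i w rewrite ⟦⟧-def ⟦ b , i ⟧ w | π₁-pair ⟦ b , i ⟧ w | π₂-pair ⟦ b , i ⟧ w
                       | π₁-pair b i | π₂-pair b i = refl

query : Baire → ℕ → ℕ → ℕ → ℕ
query x β i j = ⟦ i , code (argHalf β x) j ⟧

last-entry : ∀ x L → lookup (code x (suc L)) (last (code x (suc L))) ≡ x L
last-entry x L = trans (cong (lookup (code x (suc L))) (cong pred (length-code x (suc L))))
                       (lookup-code x (suc L) L ≤-refl)

respond-hit : ∀ x b i j → let β = side b ; L = slot β (query x β i j) in
              respond b i (code x (suc L)) ≡ assocHalf β x (query x β i j)
respond-hit x b i j = begin
  if0 (check b i w) (lookup w (last w)) 0   ≡⟨ cong (λ k → if0 k (lookup w (last w)) 0) passes ⟩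
  lookup w (last w)                         ≡⟨ last-entry x L ⟩
  x L                                       ∎
  where
  open ≡-Reasoning
  β c T L w : ℕ
  β = side b
  c = code (argHalf β x) j
  T = query x β i j
  L = slot β T
  w = code x (suc L)

  last≡L : last w ≡ L
  last≡L = cong pred (length-code x (suc L))

  candidate≡c : candidate w ≡ c
  candidate≡c = begin
    π₂ (half (half (last w))) ≡⟨ cong (λ l → π₂ (half (half l))) last≡L ⟩
    π₂ (half (half L))        ≡⟨ cong π₂ (half-half-slot β T (side≤1 b)) ⟩
    π₂ ⟦ i , c ⟧              ≡⟨ π₂-pair i c ⟩
    c                         ∎

  c-is-prefix : PrefixTest.mismatch (argEntry w β) c ≡ 0
  c-is-prefix = subst (λ d → PrefixTest.mismatch (argEntry w β) d ≡ 0)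
    (argEntries-code x β L T j refl (≤-trans (length≤code (argHalf β x) j) (snd≤pair i c)))
    (PrefixTest.mismatch-complete (argEntry w β) j)

  passes : check b i w ≡ 0
  passes = cong₂ _+_
    (m≡n⇒∣m-n∣≡0 (trans last≡L (cong (λ d → slot β ⟦ i , d ⟧) (sym candidate≡c))))
    (trans (cong (PrefixTest.mismatch (argEntry w β)) candidate≡c) c-is-prefix)

check-passes : ∀ x b i L → check b i (code x L) ≡ 0 →
  let β = side b in
  ∃ λ j → L ≡ suc (slot β (query x β i j)) × respond b i (code x L) ≡ assocHalf β x (query x β i j)
check-passes x b i L passes
  with PrefixTest.mismatch-sound (argEntry (code x L) (side b)) (candidate (code x L))
                                 (m+n≡0⇒n≡0 (slotError b i (code x L)) passes)
... | m , c≡code = located L refl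
  where
  β c : ℕ
  β = side b
  c = candidate (code x L)

  at : pred L ≡ slot β ⟦ i , c ⟧
  at = trans (sym (cong pred (length-code x L))) (∣m-n∣≡0⇒m≡n (m+n≡0⇒m≡0 (slotError b i (code x L)) passes))

  located : ∀ L′ → L′ ≡ L →
    ∃ λ j → L ≡ suc (slot β (query x β i j)) × respond b i (code x L) ≡ assocHalf β x (query x β i j)
  located zero     refl = ⊥-elim (slot≢0 β ⟦ i , c ⟧ (sym at))
  located (suc L′) refl = m , cong suc (trans at c-at) , answer
    where
    c≡arg : c ≡ code (argHalf β x) m
    c≡arg = trans c≡code (argEntries-code x β L′ ⟦ i , c ⟧ m at
              (≤-trans (subst (m ≤_) (sym c≡code) (length≤code _ m)) (snd≤pair i c)))
    c-at : slot β ⟦ i , c ⟧ ≡ slot β (query x β i m)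
    c-at = cong (λ d → slot β ⟦ i , d ⟧) c≡arg
    answer : respond b i (code x (suc L′)) ≡ assocHalf β x (query x β i m)
    answer = trans (cong (λ k → if0 k (lookup (code x (suc L′)) (last (code x (suc L′)))) 0) passes)
                   (trans (last-entry x L′) (cong x (trans at c-at)))

if0-cases : ∀ k (a : ℕ) → if0 k a 0 ≡ 0 ⊎ k ≡ 0
if0-cases zero    a = inj₂ refl
if0-cases (suc k) a = inj₁ refl

respond-cases : ∀ x b i L → let β = side b in
  respond b i (code x L) ≡ 0 ⊎
  ∃ λ j → L ≡ suc (slot β (query x β i j)) × respond b i (code x L) ≡ assocHalf β x (query x β i j)
respond-cases x b i L with if0-cases (check b i (code x L)) (lookup (code x L) (last (code x L)))
... | inj₁ nothing = inj₁ nothing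
... | inj₂ passes  = inj₂ (check-passes x b i L passes)

AssocOut-cong : ∀ {p p′ q q′ n m} → (∀ z → p z ≡ p′ z) → (∀ z → q z ≡ q′ z) →
                AssocOut p q n m → AssocOut p′ q′ n m
AssocOut-cong {p} {p′} {q} {q′} {n} p≗p′ q≗q′ (k , output , silent) =
  k , transport k output , λ j j<k → transport j (silent j j<k)
  where
  transport : ∀ k {v} → p ⟪ n , code q k ⟫ ≡ v → p′ ⟪ n , code q′ k ⟫ ≡ v
  transport k eq = trans (sym (p≗p′ _)) (trans (cong (λ c → p ⟪ n , c ⟫) (code-cong q′ q k (λ t _ → sym (q≗q′ t)))) eq)

-- Its answer comes
-- when the prefix read reaches the slot of the query the simulated associate answers at;
-- earlier slots hold that associate's "not yet" answers, and other positions give 0.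
simulate : ∀ x b i m → AssocOut (assocHalf (side b) x) (argHalf (side b) x) i m →
           AssocOut (fn univC) x ⟦ b , i ⟧ m
simulate x b i m (k , output , silent) = suc (slot β (query x β i k)) , answer , quiet
  where
  β : ℕ
  β = side b

  simulated : ∀ j → assocHalf β x (query x β i j) ≡ assocHalf β x ⟪ i , code (argHalf β x) j ⟫
  simulated j = cong (assocHalf β x) (sym (⟦⟧-def i _))

  answer : fn univC ⟪ ⟦ b , i ⟧ , code x (suc (slot β (query x β i k))) ⟫ ≡ suc m
  answer = trans (univ-query b i _) (trans (respond-hit x b i k) (trans (simulated k) output))

  earlier : ∀ j → slot β (query x β i j) < slot β (query x β i k) → j < k
  earlier j before with j <? k
  ... | yes j<k = j<k
  ... | no  j≮k = ⊥-elim (<⇒≱ before (slot-mono β (pair-monoʳ i (code-mono (argHalf β x) (≮⇒≥ j≮k)))))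

  quiet : ∀ L → L < suc (slot β (query x β i k)) → fn univC ⟪ ⟦ b , i ⟧ , code x L ⟫ ≡ 0
  quiet L (s≤s L≤slot) with respond-cases x b i L
  ... | inj₁ nothing = trans (univ-query b i _) nothing
  ... | inj₂ (j , refl , reply) =
    trans (univ-query b i _) (trans reply (trans (simulated j) (silent j (earlier j L≤slot))))

join-even : ∀ p q k → joinB p q (k * 2) ≡ p k
join-even p q zero    = refl
join-even p q (suc k) = join-even (λ i → p (suc i)) (λ i → q (suc i)) k

join-odd : ∀ p q k → joinB p q (suc (k * 2)) ≡ q k
join-odd p q zero    = refl
join-odd p q (suc k) = join-odd (λ i → p (suc i)) (λ i → q (suc i)) k

-- the Sierpiński name n ↦ r_{π₁ n}(π₂ n) (any nonzero index selects r₁)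
interleave : Baire → Baire → Baire
interleave r₀ r₁ n = if0 (π₁ n) r₀ r₁ (π₂ n)

univ-joined : ∀ p q r₀ r₁ → Φ (odds p) (evens q) r₀ → Φ (odds q) (evens p) r₁ →
              Φ (fn univC) (joinB p q) (interleave r₀ r₁)
univ-joined p q r₀ r₁ Φ₀ Φ₁ n =
  subst (λ n′ → AssocOut (fn univC) x n′ (interleave r₀ r₁ n)) (pair-π n) (both (π₁ n) (π₂ n))
  where
  x : Baire
  x = joinB p q

  both : ∀ b i → AssocOut (fn univC) x ⟦ b , i ⟧ (if0 b r₀ r₁ i)
  both zero    i = simulate x zero i (r₀ i)
    (AssocOut-cong {n = i} (λ T → sym (join-even p q (suc (T * 2)))) (λ t → sym (join-odd p q (t * 2))) (Φ₀ i))
  both (suc b) i = simulate x (suc b) i (r₁ i)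
    (AssocOut-cong {n = i} (λ T → sym (join-odd p q (suc (T * 2)))) (λ t → sym (join-even p q (t * 2))) (Φ₁ i))

interleave-names : ∀ {P Q : Set} r₀ r₁ → NamesS r₀ P → NamesS r₁ Q → NamesS (interleave r₀ r₁) (P ⊎ Q)
interleave-names {P} {Q} r₀ r₁ (P⇒ , ⇒P) (Q⇒ , ⇒Q) = forward , backward
  where
  at : ∀ b i → interleave r₀ r₁ ⟦ b , i ⟧ ≡ if0 b r₀ r₁ i
  at b i = cong₂ (λ c j → if0 c r₀ r₁ j) (π₁-pair b i) (π₂-pair b i)

  witness : ∀ b → (∃ λ i → if0 b r₀ r₁ i ≢ 0) → ∃ λ n → interleave r₀ r₁ n ≢ 0
  witness b (i , nonzero) = ⟦ b , i ⟧ , λ eq → nonzero (trans (sym (at b i)) eq)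

  forward : P ⊎ Q → ∃ λ n → interleave r₀ r₁ n ≢ 0
  forward (inj₁ p) = witness 0 (P⇒ p)
  forward (inj₂ q) = witness 1 (Q⇒ q)

  backward : (∃ λ n → interleave r₀ r₁ n ≢ 0) → P ⊎ Q
  backward (n , nonzero) = from (π₁ n) nonzero
    where
    from : ∀ b → if0 b r₀ r₁ (π₂ n) ≢ 0 → P ⊎ Q
    from zero    nonzero = inj₁ (⇒P (π₂ n , nonzero))
    from (suc _) nonzero = inj₂ (⇒Q (π₂ n , nonzero))

NamesS-⇔ : ∀ {r P Q} → NamesS r P → P ⇔ Q → NamesS r Q
NamesS-⇔ (P⇒ , ⇒P) P⇔Q = (λ q → P⇒ (Equivalence.from P⇔Q q)) , (λ nz → Equivalence.to P⇔Q (⇒P nz))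

differ⇔ : ExcludedMiddle 0ℓ → ∀ {X : Set} (A B : Subset X) →
          ((∃ λ x → A x × ¬ B x) ⊎ (∃ λ x → B x × ¬ A x)) ⇔ (¬ (A ≈ₛ B))
differ⇔ lem A B = mk⇔ separate differ
  where
  separate : (∃ λ x → A x × ¬ B x) ⊎ (∃ λ x → B x × ¬ A x) → ¬ (A ≈ₛ B)
  separate (inj₁ (x , Ax , ¬Bx)) A≈B = ¬Bx (proj₁ (A≈B x) Ax)
  separate (inj₂ (x , Bx , ¬Ax)) A≈B = ¬Ax (proj₂ (A≈B x) Bx)

  differ : ¬ (A ≈ₛ B) → (∃ λ x → A x × ¬ B x) ⊎ (∃ λ x → B x × ¬ A x)
  differ A≉B = decidable-stable lem λ neither → A≉B λ x →
    (λ Ax → decidable-stable lem λ ¬Bx → neither (inj₁ (x , Ax , ¬Bx))) ,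
    (λ Bx → decidable-stable lem λ ¬Ax → neither (inj₂ (x , Bx , ¬Ax)))

corollary29 : ExcludedMiddle 0ℓ → (𝐗 : RepSpace) → AVComputablyHausdorff 𝐗
corollary29 lem 𝐗 = fn univC , (prog univC , computes univC) , realiser
  where
  open RepSpace 𝐗
  realiser : ∀ p q (A B : Subset Carrier) → NamesAV 𝐗 p A → NamesAV 𝐗 q B →
             Σ Baire λ r → Φ (fn univC) (joinB p q) r × NamesS r (¬ (A ≈ₛ B))
  realiser p q A B (aA , vA) (aB , vB)
    with vA (evens q) (λ x → ¬ B x) aB | vB (evens p) (λ x → ¬ A x) aA
  ... | r₀ , Φ₀ , names₀ | r₁ , Φ₁ , names₁ =
    interleave r₀ r₁ , univ-joined p q r₀ r₁ Φ₀ Φ₁ ,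
    NamesS-⇔ (interleave-names r₀ r₁ names₀ names₁) (differ⇔ lem A B)
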